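{- Let $X$ be a strongly complete space and $Y$ a subspace of $X$. If $Y$ is an $I$-closed subset of $X$, then $Y$, with the relative topology, is a strongly complete space.
   Context: All spaces are $T_0$ topological spaces, with specialization order $x \leq y$ iff every open set containing $x$ contains $y$; suprema refer to this order. A nonempty subset $F$ of a space is irreducible if whenever $F \subseteq A \cup B$ with $A, B$ closed, then $F \subseteq A$ or $F \subseteq B$; $\operatorname{Irr}^{+}(X)$ is the set of irreducible subsets of $X$ with a supremum in $X$. A subset $A$ of $X$ is $I$-closed if for every $F \in \operatorname{Irr}^{+}(X)$ with $F \subseteq A$ one has $\bigvee F \in A$. A space is strongly complete if every irreducible subset has a supremum. -}

module Defs where

open import Level using (Level; _⊔_; suc; zero)
open import Data.Product using (Σ; ∃; _×_; _,_; proj₁; proj₂)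
open import Data.Sum using (_⊎_)
open import Data.Unit using (⊤)
open import Relation.Nullary using (¬_)
open import Relation.Binary.PropositionalEquality using (_≡_)

Subset : Set → Set₁
Subset X = X → Set

_⊆_ : {X : Set} → Subset X → Subset X → Set
A ⊆ B = ∀ x → A x → B x

_∪_ : {X : Set} → Subset X → Subset X → Subset X
(A ∪ B) x = A x ⊎ B x

_∩_ : {X : Set} → Subset X → Subset X → Subset X
(A ∩ B) x = A x × B x

_≐_ : {X : Set} → Subset X → Subset X → Set
A ≐ B = (A ⊆ B) × (B ⊆ A)

record Topology (X : Set) : Set₂ where
  field
    IsOpen    : Subset X → Set₁
    open-ext  : ∀ {U V} → U ≐ V → IsOpen U → IsOpen V
    open-univ : IsOpen (λ _ → ⊤)
    open-∩    : ∀ {U V} → IsOpen U → IsOpen V → IsOpen (U ∩ V)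
    open-⋃    : (I : Set) (U : I → Subset X) → (∀ i → IsOpen (U i)) →
                IsOpen (λ x → Σ I (λ i → U i x))

record Space : Set₂ where
  field
    Carrier : Set
    topology : Topology Carrier
  open Topology topology public

module _ (S : Space) where
  open Space S

  IsClosed : Subset Carrier → Set₁
  IsClosed A = Σ (Subset Carrier) λ U → IsOpen U × (∀ x → A x → ¬ U x) × (∀ x → ¬ U x → A x)

  _≤ₛ_ : Carrier → Carrier → Set₁
  x ≤ₛ y = ∀ (U : Subset Carrier) → IsOpen U → U x → U y

  IsT0 : Set₁
  IsT0 = ∀ x y → x ≤ₛ y → y ≤ₛ x → x ≡ y

  Irreducible : Subset Carrier → Set₁
  Irreducible F = (Σ Carrier F) ×
    (∀ A B → IsClosed A → IsClosed B → F ⊆ (A ∪ B) → (F ⊆ A) ⊎ (F ⊆ B))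

  IsSup : Subset Carrier → Carrier → Set₁
  IsSup F s = (∀ x → F x → x ≤ₛ s) × (∀ u → (∀ x → F x → x ≤ₛ u) → s ≤ₛ u)

  IsStronglyComplete : Set₁
  IsStronglyComplete = ∀ F → Irreducible F → Σ Carrier (IsSup F)

  IsIClosed : Subset Carrier → Set₁
  IsIClosed A = ∀ F → Irreducible F → (s : Carrier) → IsSup F s → F ⊆ A → A s

-- Subspace with the relative topology: carrier Σ X Y, opens are the
-- traces U ∩ Y of open sets U of X.
Subspace : (S : Space) → Subset (Space.Carrier S) → Space
Subspace S Y = record
  { Carrier = Σ (Space.Carrier S) Y
  ; topology = record
    { IsOpen = λ V → Σ (Subset (Space.Carrier S)) λ U → Space.IsOpen S U ×
                       (∀ (y : Σ (Space.Carrier S) Y) → (V y → U (proj₁ y)) × (U (proj₁ y) → V y))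
    ; open-ext = λ { {U} {V} (U⊆V , V⊆U) (W , oW , e) →
        W , oW , λ y → (λ v → proj₁ (e y) (V⊆U y v)) , (λ w → U⊆V y (proj₂ (e y) w)) }
    ; open-univ = (λ _ → ⊤) , Space.open-univ S , λ y → (λ _ → _) , (λ _ → _)
    ; open-∩ = λ { (U₁ , o₁ , e₁) (U₂ , o₂ , e₂) →
        (U₁ ∩ U₂) , Space.open-∩ S o₁ o₂ ,
        λ y → (λ { (a , b) → proj₁ (e₁ y) a , proj₁ (e₂ y) b })
            , (λ { (a , b) → proj₂ (e₁ y) a , proj₂ (e₂ y) b }) }
    ; open-⋃ = λ I V oV →
        (λ x → Σ I λ i → proj₁ (oV i) x) ,
        Space.open-⋃ S I (λ i → proj₁ (oV i)) (λ i → proj₁ (proj₂ (oV i))) ,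
        λ y → (λ { (i , v) → i , proj₁ (proj₂ (proj₂ (oV i)) y) v })
            , (λ { (i , u) → i , proj₂ (proj₂ (proj₂ (oV i)) y) u })
    }
  }

-- T₀ for a subspace, stated on underlying points of X (elements of the
-- subspace carrier Σ X Y carry a membership proof, which need not be
-- propositionally unique in Agda).
SubspaceIsT0 : (S : Space) (Y : Subset (Space.Carrier S)) → Set₁
SubspaceIsT0 S Y = ∀ x y → _≤ₛ_ (Subspace S Y) x y → _≤ₛ_ (Subspace S Y) y x → proj₁ x ≡ proj₁ y

module Submission where

-- The specialization order of a subspace is the restriction of that of X, and
-- an irreducible F in Y is irreducible in X (closed sets of Y are traces of
-- closed sets of X). So F has a supremum s in X; I-closedness puts s in Y,
-- where it is still the supremum.

open import Defs
open import Data.Product using (_×_; Σ; _,_; proj₁; proj₂)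
open import Data.Sum using (_⊎_; map)
open import Function using (_∘_)

module _ (X : Space) (Y : Subset (Space.Carrier X)) where
  open Space X

  private
    XY = Subspace X Y

  underlying : Subset (Space.Carrier XY) → Subset Carrier
  underlying F x = Σ (Y x) λ y → F (x , y)

  underlying⊆ : (F : Subset (Space.Carrier XY)) → underlying F ⊆ Y
  underlying⊆ F x (y , _) = y

  restrict-open : ∀ {U} → IsOpen U → Space.IsOpen XY (U ∘ proj₁)
  restrict-open {U} oU = U , oU , λ _ → (λ u → u) , (λ u → u)

  restrict-closed : ∀ {A} → IsClosed X A → IsClosed XY (A ∘ proj₁)
  restrict-closed (U , oU , A⇒¬U , ¬U⇒A) =
    U ∘ proj₁ , restrict-open oU , A⇒¬U ∘ proj₁ , ¬U⇒A ∘ proj₁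

  subspace-≤⇒≤ : ∀ x y → _≤ₛ_ XY x y → _≤ₛ_ X (proj₁ x) (proj₁ y)
  subspace-≤⇒≤ x y x≤y U oU = x≤y (U ∘ proj₁) (restrict-open oU)

  ≤⇒subspace-≤ : ∀ x y → _≤ₛ_ X (proj₁ x) (proj₁ y) → _≤ₛ_ XY x y
  ≤⇒subspace-≤ x y x≤y V (U , oU , V⇔U) v =
    proj₂ (V⇔U y) (x≤y U oU (proj₁ (V⇔U x) v))

  subspace-T0 : IsT0 X → SubspaceIsT0 X Y
  subspace-T0 t0 x y x≤y y≤x =
    t0 (proj₁ x) (proj₁ y) (subspace-≤⇒≤ x y x≤y) (subspace-≤⇒≤ y x y≤x)

  underlying-irreducible : ∀ {F} → Irreducible XY F → Irreducible X (underlying F)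
  underlying-irreducible {F} (((x , y) , Fxy) , irr) = (x , y , Fxy) , split
    where
    split : ∀ A B → IsClosed X A → IsClosed X B → underlying F ⊆ (A ∪ B) →
            (underlying F ⊆ A) ⊎ (underlying F ⊆ B)
    split A B cA cB F⊆A∪B =
      map (λ F⊆A x (y , Fxy) → F⊆A (x , y) Fxy)
          (λ F⊆B x (y , Fxy) → F⊆B (x , y) Fxy)
          (irr (A ∘ proj₁) (B ∘ proj₁) (restrict-closed cA) (restrict-closed cB)
               (λ (x , y) Fxy → F⊆A∪B x (y , Fxy)))

  sup-underlying⇒sup : ∀ {F s} → IsSup X (underlying F) s → (ys : Y s) →
                       IsSup XY F (s , ys)
  sup-underlying⇒sup {F} {s} (upper , least) ys = upper′ , least′
    where
    upper′ : ∀ z → F z → _≤ₛ_ XY z (s , ys)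
    upper′ (x , y) Fxy = ≤⇒subspace-≤ (x , y) (s , ys) (upper x (y , Fxy))

    least′ : ∀ u → (∀ z → F z → _≤ₛ_ XY z u) → _≤ₛ_ XY (s , ys) u
    least′ u F≤u = ≤⇒subspace-≤ (s , ys) u (least (proj₁ u)
      λ x (y , Fxy) → subspace-≤⇒≤ (x , y) u (F≤u (x , y) Fxy))

  IClosed⇒subspace-stronglyComplete : IsStronglyComplete X → IsIClosed X Y →
                                      IsStronglyComplete XY
  IClosed⇒subspace-stronglyComplete sc ic F irrF =
    (s , ys) , sup-underlying⇒sup s-sup ys
    where
    irr : Irreducible X (underlying F)
    irr = underlying-irreducible irrF

    s = proj₁ (sc (underlying F) irr)
    s-sup = proj₂ (sc (underlying F) irr)

    ys : Y s
    ys = ic (underlying F) irr s s-sup (underlying⊆ F)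

corollary3p8 : (X : Space) → IsT0 X → IsStronglyComplete X →
    (Y : Subset (Space.Carrier X)) → IsIClosed X Y →
    SubspaceIsT0 X Y × IsStronglyComplete (Subspace X Y)
corollary3p8 X t0 sc Y ic =
  subspace-T0 X Y t0 , IClosed⇒subspace-stronglyComplete X Y sc ic
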